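{- Let $s,m$ be positive integers and let $\lambda$ be a nonempty $(s,ms-1,ms+1)$-core partition. Then the $\beta$-set $\beta(\lambda)$ of $\lambda$ is a generalized-$\beta$-set.
   Context: A partition $\lambda$ is an $r$-core if none of its hook lengths is divisible by $r$, and an $(s,ms-1,ms+1)$-core if it is simultaneously an $s$-core, an $(ms-1)$-core and an $(ms+1)$-core. The $\beta$-set of $\lambda=(\lambda_1\ge\dots\ge\lambda_\ell>0)$ is $\{\lambda_i+\ell-i:1\le i\le\ell\}$ (first-column hook lengths). Let $N=\lceil (s-1)/2\rceil m$. Define $\mathcal L_m(s)=\bigcup_{k=1}^mP_k$ with $P_k=\{\,i\,ms+j: i\ge0,\ (k-1)s+1+i\le j\le ks-1-i\,\}$ for $1\le k\le m-1$ and $P_m=\{\,i\,ms+j: i\ge0,\ (m-1)s+1+i\le j\le ms-2-i\,\}$. For a nonempty set $S\subseteq\{1,\dots,Ns-1\}$ let $t=t(S)=\min\{i\ge1: S\subseteq[0,ims-1]\}$, and for $1\le i\le N$ let $\mathcal B_i=S\cap[(i-1)s,is-1]$, $a_i=|\mathcal B_i|$, and $n_i=\max\{x\bmod s: x\in\mathcal B_i\}$ ($n_i=0$ if $\mathcal B_i=\emptyset$). A nonempty set $S\subseteq\mathcal L_m(s)$ is a generalized-$\beta$-set if: (1) for $1\le i<N$, $a_i=0$ implies $a_{i+1}=0$; (2) for $1\le i<tm$ with $m\nmid i$, $a_i\ge a_{i+1}$; (3) for $1\le i\le (t-1)m$ with $a_{i+m}>0$, $a_{i+m}\le a_i-2$;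 (4) for $1\le i<tm$ with $m\nmid i$ and $a_{i+1}>0$, $n_i\ge n_{i+1}$; (5) for $1\le i<tm$ with $m\nmid i$ and $a_i=a_{i+1}>0$, $n_i=n_{i+1}$; (6) if $t\ge2$, $a_{(t-1)m}\ge a_{(t-1)m+1}$. -}

module Defs where

open import Data.Nat using (ℕ; zero; suc; _+_; _*_; _∸_; _≤_; _<_; _⊔_; _<?_; NonZero)
open import Data.Nat.Properties using (_≟_)
open import Data.Nat.DivMod using (_%_; _/_)
open import Data.Nat.Divisibility using (_∣_)
open import Data.List using (List; []; _∷_; length; filter; map; upTo; foldr)
open import Data.List.Relation.Unary.All using (All)
open import Data.List.Relation.Unary.Linked using (Linked)
open import Data.List.Membership.Propositional using (_∈_)
open import Data.List.Membership.DecPropositional _≟_ using (_∈?_)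
open import Data.Product using (Σ; ∃; _×_)
open import Relation.Nullary using (¬_)
open import Relation.Binary.PropositionalEquality using (_≡_; _≢_)

IsPartition : List ℕ → Set
IsPartition la = Linked (λ a b → b ≤ a) la × All (λ a → 0 < a) la

-- 0-indexed lookup with default 0
nth : List ℕ → ℕ → ℕ
nth []       _       = 0
nth (x ∷ _)  zero    = x
nth (_ ∷ xs) (suc i) = nth xs i

-- conjugate part λ'_j (0-indexed column j): number of parts > j
conj : List ℕ → ℕ → ℕ
conj la j = length (filter (j <?_) la)

-- hook length of the cell in row i, column j (both 0-indexed):
-- arm + leg + 1
hook : List ℕ → ℕ → ℕ → ℕ
hook la i j = (nth la i ∸ suc j) + (conj la j ∸ suc i) + 1

IsCore : ℕ → List ℕ → Set
IsCore r la = ∀ i j → i < length la → j < nth la i → ¬ (r ∣ hook la i j)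

-- β-set: { λ_i + ℓ - i : 1 ≤ i ≤ ℓ }
beta : List ℕ → List ℕ
beta []       = []
beta (x ∷ xs) = (x + length xs) ∷ beta xs

InP : (m s k x : ℕ) → Set
InP m s k x = Σ ℕ λ i → Σ ℕ λ j →
    (x ≡ i * m * s + j)
  × ((k ∸ 1) * s + 1 + i ≤ j)
  × (j + i + 1 ≤ k * s)
  × (k ≡ m → j + i + 2 ≤ m * s)

InL : (m s x : ℕ) → Set
InL m s x = Σ ℕ λ k → (1 ≤ k) × (k ≤ m) × InP m s k x

block : (s : ℕ) → List ℕ → ℕ → List ℕ
block s S i = filter (_∈? S) (map ((i ∸ 1) * s +_) (upTo s))

acount : (s : ℕ) → List ℕ → ℕ → ℕ
acount s S i = length (block s S i)

-- n_i = max { x mod s : x ∈ 𝓑_i } (0 if empty)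
nmax : (s : ℕ) .{{_ : NonZero s}} → List ℕ → ℕ → ℕ
nmax s S i = foldr _⊔_ 0 (map (_% s) (block s S i))

IsT : (m s : ℕ) → List ℕ → ℕ → Set
IsT m s S t = (1 ≤ t)
            × (∀ x → x ∈ S → x < t * m * s)
            × (∀ i → 1 ≤ i → (∀ x → x ∈ S → x < i * m * s) → t ≤ i)

-- N = ⌈(s-1)/2⌉ m
Nval : (m s : ℕ) → ℕ
Nval m s = ((s ∸ 1 + 1) / 2) * m

GenBeta : (m s : ℕ) .{{_ : NonZero s}} → List ℕ → Set
GenBeta m s S =
    (S ≢ [])
  × All (InL m s) S
  × Σ ℕ λ t → IsT m s S t
  × (∀ i → 1 ≤ i → i < Nval m s → a i ≡ 0 → a (suc i) ≡ 0)                       -- (1)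
  × (∀ i → 1 ≤ i → i < t * m → ¬ (m ∣ i) → a (suc i) ≤ a i)                      -- (2)
  × (∀ i → 1 ≤ i → i ≤ (t ∸ 1) * m → 0 < a (i + m) → a (i + m) + 2 ≤ a i)        -- (3)
  × (∀ i → 1 ≤ i → i < t * m → ¬ (m ∣ i) → 0 < a (suc i) → n (suc i) ≤ n i)      -- (4)
  × (∀ i → 1 ≤ i → i < t * m → ¬ (m ∣ i) → a i ≡ a (suc i) → 0 < a i → n i ≡ n (suc i)) -- (5)
  × (2 ≤ t → a ((t ∸ 1) * m + 1) ≤ a ((t ∸ 1) * m))                               -- (6)
  where
  a = acount s S
  n = nmax s S

-- A partition λ is an r-core exactly when its β-set X is closed under y + r ↦ y
-- (a hook of length r is a pair y ∉ X, y + r ∈ X).  For r = s, ms−1, ms+1 and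
-- 0 ∉ X, this makes X disjoint from the numerical semigroup ⟨s, ms−1, ms+1⟩.
-- Writing x = i·ms + k·s + r (r < s, k < m), x lies in that semigroup unless
-- i < r, r + i < s and, when k = m−1, r + i + 1 < s: this is membership in L_m(s).
-- Let Oᵢ be the set of offsets r < s with (i−1)s + r ∈ X.  Closure under s gives
-- Oᵢ₊₁ ⊆ Oᵢ as sublists of [0..s), whence (1), (2), (4), (5), (6) for every i.
-- For (3), closure under ms gives Oᵢ₊ₘ ⊆ Oᵢ.  The offsets 0 and s−1 are never in
-- Oᵢ₊ₘ, so a run of Oᵢ₊ₘ has a left neighbour u and a right neighbour v inside
-- [0..s); closure under ms+1 and ms−1 puts u and v into Oᵢ.

module Submission where

open import Defs
open import Data.Bool using (true; false)
open import Data.Nat using (ℕ; zero; suc; _+_; _*_; _∸_; _≤_; _<_; _⊔_; _<?_; z≤n; s≤s; NonZero)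
open import Data.Nat.Properties
open import Data.Nat.DivMod using (_%_; _/_; m≡m%n+[m/n]*n; m%n<n; m<n*o⇒m/o<n; [m+kn]%n≡m%n)
open import Data.Nat.Divisibility using (_∣_; ∣-refl)
open import Data.Nat.Tactic.RingSolver using (solve-∀)
open import Data.List using (List; []; _∷_; length; filter; map; upTo; foldr)
open import Data.List.Properties using (filter-accept; filter-reject; length-map; map-∘; map-cong; foldr-preservesᵇ)
open import Data.List.Relation.Unary.All as All using (All; []; _∷_)
open import Data.List.Relation.Unary.Any using (here; there)
open import Data.List.Relation.Unary.Linked as Linked using (Linked)
open import Data.List.Relation.Unary.Linked.Properties using (Linked⇒AllPairs)
open import Data.List.Relation.Unary.AllPairs using (_∷_)
open import Data.List.Relation.Binary.Sublist.Propositional using (_⊆_; []; _∷_; _∷ʳ_; ⊆-refl)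
open import Data.List.Relation.Binary.Sublist.Propositional.Properties using (filter⁺; length-mono-≤; to-≋; map⁺)
open import Data.List.Relation.Binary.Equality.Propositional using (≋⇒≡)
open import Data.List.Membership.Propositional using (_∈_; _∉_)
open import Data.List.Membership.Propositional.Properties using (∈-filter⁺; ∈-filter⁻; ∈-upTo⁺; ∈-upTo⁻)
open import Data.List.Membership.DecPropositional _≟_ using (_∈?_)
open import Data.Product using (∃-syntax; _×_; _,_; proj₂)
open import Data.Sum using (_⊎_; inj₁; inj₂; [_,_])
open import Function using (_∘_; flip)
open import Level using (0ℓ)
open import Relation.Nullary using (¬_; yes; no; contradiction; does)
open import Relation.Nullary.Decidable using (¬?; decidable-stable; _⊎-dec_)
open import Relation.Unary using (Pred; Decidable)
open import Relation.Binary.Definitions using (DecidableEquality; tri<; tri≈; tri>)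
open import Relation.Binary.PropositionalEquality
  using (_≡_; _≢_; refl; sym; trans; cong; subst; subst₂; module ≡-Reasoning)

Closed : ℕ → List ℕ → Set
Closed q X = ∀ y → y + q ∈ X → y ∈ X

closed-shift : ∀ {q X} → Closed q X → ∀ b r → q + b + r ∈ X → b + r ∈ X
closed-shift {q} {X} closed b r h = closed (b + r) (subst (_∈ X) (arith q b r) h)
  where
  arith : ∀ q b r → q + b + r ≡ b + r + q
  arith = solve-∀

closed-multiple : ∀ {q X} → Closed q X → ∀ k → Closed (k * q) X
closed-multiple {X = X} closed zero    y y∈ = subst (_∈ X) (+-identityʳ y) y∈
closed-multiple {q} {X} closed (suc k) y y∈ =
  closed-multiple closed k y (closed (y + k * q) (subst (_∈ X) (arith y q k) y∈))
  where
  arith : ∀ y q k → y + (q + k * q) ≡ y + k * q + q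
  arith = solve-∀

Decreasing : List ℕ → Set
Decreasing = Linked (flip _≤_)

parts≤head : ∀ {x xs} → Decreasing (x ∷ xs) → All (_≤ x) xs
parts≤head dec with Linked⇒AllPairs (flip ≤-trans) dec
... | x≥xs ∷ _ = x≥xs

conj-∷-< : ∀ {j x xs} → j < x → conj (x ∷ xs) j ≡ suc (conj xs j)
conj-∷-< {j} j<x = cong length (filter-accept (j <?_) j<x)

conj-≡0 : ∀ {j xs} → All (_≤ j) xs → conj xs j ≡ 0
conj-≡0 [] = refl
conj-≡0 {j} (x≤j ∷ xs≤j) =
  trans (cong length (filter-reject (j <?_) (≤⇒≯ x≤j))) (conj-≡0 xs≤j)

nth≤ : ∀ {x ys} → All (_≤ x) ys → ∀ k → nth ys k ≤ x
nth≤ []         _       = z≤n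
nth≤ (y≤x ∷ _)  zero    = y≤x
nth≤ (_ ∷ ys≤x) (suc k) = nth≤ ys≤x k

hook-tail : ∀ {x xs} i j → Decreasing (x ∷ xs) → j < nth xs i →
            hook (x ∷ xs) (suc i) j ≡ hook xs i j
hook-tail {x} {xs} i j dec j<xsᵢ
  rewrite conj-∷-< {j} {x} {xs} (<-≤-trans j<xsᵢ (nth≤ (parts≤head dec) i)) = refl

core-tail : ∀ {r x xs} → IsPartition (x ∷ xs) → IsCore r (x ∷ xs) → IsCore r xs
core-tail {r} (dec , _) core i j i<ℓ j<xsᵢ r∣hook =
  core (suc i) j (s≤s i<ℓ) j<xsᵢ (subst (r ∣_) (sym (hook-tail i j dec j<xsᵢ)) r∣hook)

β-gap⇒column : ∀ {x} xs → IsPartition xs → All (_≤ x) xs →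
               ∀ y → y < x + length xs → y ∉ beta xs →
               ∃[ j ] j < x × y + conj xs j ≡ j + length xs
β-gap⇒column [] _ _ y y<x _ = y , subst (y <_) (+-identityʳ _) y<x , refl
β-gap⇒column {x} (z ∷ zs) (dec , pos) (z≤x ∷ _) y y<bound y∉β
  with <-cmp y (z + length zs)
... | tri≈ _ y≡z+ℓ _ = contradiction (here y≡z+ℓ) y∉β
... | tri< y<z+ℓ _ _
  with j , j<z , eq ← β-gap⇒column zs (Linked.tail dec , All.tail pos) (parts≤head dec)
                        y y<z+ℓ (λ y∈ → y∉β (there y∈)) =
  j , <-≤-trans j<z z≤x , (begin
    y + conj (z ∷ zs) j    ≡⟨ cong (y +_) (conj-∷-< {j} {z} {zs} j<z) ⟩
    y + suc (conj zs j)    ≡⟨ +-suc y _ ⟩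
    suc (y + conj zs j)    ≡⟨ cong suc eq ⟩
    suc (j + length zs)    ≡⟨ +-suc j _ ⟨
    j + length (z ∷ zs)    ∎)
  where open ≡-Reasoning
... | tri> _ _ z+ℓ<y
  with d , refl ← m≤n⇒∃[o]m+o≡n z+ℓ<y =
  z + d , +-cancelʳ-< (suc ℓ) (z + d) x (subst (_< x + suc ℓ) shift y<bound) , (begin
    suc (z + ℓ) + d + conj (z ∷ zs) (z + d)  ≡⟨ cong (suc (z + ℓ) + d +_) (conj-≡0 z∷zs≤z+d) ⟩
    suc (z + ℓ) + d + 0                      ≡⟨ +-identityʳ _ ⟩
    suc (z + ℓ) + d                          ≡⟨ shift ⟩
    z + d + suc ℓ                            ∎)
  where
  open ≡-Reasoning
  ℓ : ℕ
  ℓ = length zs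
  shift : suc (z + ℓ) + d ≡ z + d + suc ℓ
  shift = arith z ℓ d
    where
    arith : ∀ a b c → suc (a + b) + c ≡ a + c + suc b
    arith = solve-∀
  z∷zs≤z+d : All (_≤ z + d) (z ∷ zs)
  z∷zs≤z+d = All.map (λ v≤z → ≤-trans v≤z (m≤m+n z d)) (≤-refl ∷ parts≤head dec)

first-row-hook : ∀ {x xs j y r} → j < x → y + r ≡ x + length xs →
                 y + conj xs j ≡ j + length xs → hook (x ∷ xs) 0 j ≡ r
first-row-hook {x} {xs} {j} {y} {r} j<x y+r≡ y+c≡ = begin
  (x ∸ suc j) + (conj (x ∷ xs) j ∸ 1) + 1  ≡⟨ cong (λ c → d + (c ∸ 1) + 1) (conj-∷-< {j} {x} {xs} j<x) ⟩
  d + c + 1                                ≡⟨ +-cancelˡ-≡ (j + ℓ) _ _ cancelled ⟩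
  r                                        ∎
  where
  open ≡-Reasoning
  ℓ c d : ℕ
  ℓ = length xs
  c = conj xs j
  d = x ∸ suc j
  cancelled : j + ℓ + (d + c + 1) ≡ j + ℓ + r
  cancelled = begin
    j + ℓ + (d + c + 1)  ≡⟨ arith₁ j ℓ d c ⟩
    suc j + d + ℓ + c    ≡⟨ cong (λ v → v + ℓ + c) (m+[n∸m]≡n j<x) ⟩
    x + ℓ + c            ≡⟨ cong (_+ c) y+r≡ ⟨
    y + r + c            ≡⟨ arith₂ y r c ⟩
    y + c + r            ≡⟨ cong (_+ r) y+c≡ ⟩
    j + ℓ + r            ∎
    where
    arith₁ : ∀ j ℓ d c → j + ℓ + (d + c + 1) ≡ suc j + d + ℓ + c
    arith₁ = solve-∀
    arith₂ : ∀ y r c → y + r + c ≡ y + c + r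
    arith₂ = solve-∀

core⇒β-closed : ∀ {r} la → IsPartition la → IsCore r la → Closed r (beta la)
core⇒β-closed (x ∷ xs) (dec , pos) core y (there y+r∈β) =
  there (core⇒β-closed xs (Linked.tail dec , All.tail pos) (core-tail (dec , pos) core) y y+r∈β)
core⇒β-closed {r} (x ∷ xs) (dec , pos) core y (here y+r≡) with y ∈? beta (x ∷ xs)
... | yes y∈β = y∈β
... | no y∉β with m≤n⇒m<n∨m≡n (subst (y ≤_) y+r≡ (m≤m+n y r))
...   | inj₂ y≡ = contradiction (here y≡) y∉β
...   | inj₁ y<
  with j , j<x , y+c≡ ← β-gap⇒column xs (Linked.tail dec , All.tail pos) (parts≤head dec)
                          y y< (λ y∈ → y∉β (there y∈)) =
  contradiction (subst (r ∣_) (sym (first-row-hook j<x y+r≡ y+c≡)) ∣-refl) (core 0 j (s≤s z≤n) j<x)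

0∉β : ∀ {la} → All (0 <_) la → 0 ∉ beta la
0∉β {x ∷ _} (0<x ∷ _)  (here 0≡)  = <⇒≢ (≤-trans 0<x (m≤m+n x _)) 0≡
0∉β         (_ ∷ pos)  (there 0∈) = 0∉β pos 0∈

max : List ℕ → ℕ
max = foldr _⊔_ 0

module _ {A B : Set} {P : Pred B 0ℓ} (P? : Decidable P) (f : A → B) where

  filter-map : ∀ xs → filter P? (map f xs) ≡ map f (filter (P? ∘ f) xs)
  filter-map []       = refl
  filter-map (x ∷ xs) with does (P? (f x))
  ... | true  = cong (f x ∷_) (filter-map xs)
  ... | false = filter-map xs

⊆-length-< : ∀ {A : Set} {x : A} {xs ys} → xs ⊆ ys → x ∈ ys → x ∉ xs → length xs < length ys
⊆-length-< (y ∷ʳ xs⊆ys) _ _ = s≤s (length-mono-≤ xs⊆ys)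
⊆-length-< (refl ∷ xs⊆ys) (here refl) x∉ = contradiction (here refl) x∉
⊆-length-< (refl ∷ xs⊆ys) (there x∈) x∉ = s≤s (⊆-length-< xs⊆ys x∈ (x∉ ∘ there))

module _ {A : Set} {P Q : Pred A 0ℓ} (P? : Decidable P) (Q? : Decidable Q) (P⇒Q : ∀ {x} → P x → Q x) where

  filter-length-< : ∀ {x} xs → x ∈ xs → Q x → ¬ P x → length (filter P? xs) < length (filter Q? xs)
  filter-length-< xs x∈ Qx ¬Px =
    ⊆-length-< (filter⁺ P? Q? (λ { refl → P⇒Q }) (⊆-refl {x = xs}))
               (∈-filter⁺ Q? x∈ Qx) (¬Px ∘ proj₂ ∘ ∈-filter⁻ P? {xs = xs})

⊆-length-≡ : ∀ {A : Set} {xs ys : List A} → length xs ≡ length ys → xs ⊆ ys → xs ≡ ys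
⊆-length-≡ eq xs⊆ys = ≋⇒≡ (to-≋ eq xs⊆ys)

max-mono : ∀ {xs ys} → xs ⊆ ys → max xs ≤ max ys
max-mono []              = z≤n
max-mono (y ∷ʳ xs⊆ys)    = ≤-trans (max-mono xs⊆ys) (m≤n⊔m y _)
max-mono (refl ∷ xs⊆ys)  = ⊔-monoʳ-≤ _ (max-mono xs⊆ys)

∈⇒≤max : ∀ {x xs} → x ∈ xs → x ≤ max xs
∈⇒≤max (here refl) = m≤m⊔n _ _
∈⇒≤max (there x∈)  = ≤-trans (∈⇒≤max x∈) (m≤n⊔m _ _)

max< : ∀ {xs b} → xs ≢ [] → (∀ {x} → x ∈ xs → x < b) → max xs < b
max< {[]}    xs≢[] _    = contradiction refl xs≢[]
max< {x ∷ _} _     xs<b = foldr-preservesᵇ ⊔-lub (≤-<-trans z≤n (xs<b (here refl))) (All.tabulate xs<b)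

0<length⇒∃∈ : ∀ {A : Set} {xs : List A} → 0 < length xs → ∃[ x ] x ∈ xs
0<length⇒∃∈ {xs = x ∷ _} _ = x , here refl

module _ {A : Set} (_≟ₐ_ : DecidableEquality A) {P Q : Pred A 0ℓ} (P? : Decidable P) (Q? : Decidable Q)
         (P⇒Q : ∀ {x} → P x → Q x) where

  filter-length-+2 : ∀ xs {u v} → u ∈ xs → v ∈ xs → u ≢ v → Q u → ¬ P u → Q v → ¬ P v →
                     length (filter P? xs) + 2 ≤ length (filter Q? xs)
  filter-length-+2 xs {u} u∈ v∈ u≢v Qu ¬Pu Qv ¬Pv =
    subst (_≤ length (filter Q? xs)) (+-comm 2 _)
      (≤-trans (s≤s (filter-length-< P? P∪u? inj₁ xs u∈ (inj₂ refl) ¬Pu))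
               (filter-length-< P∪u? Q? [ P⇒Q , (λ { refl → Qu }) ] xs v∈ Qv [ ¬Pv , u≢v ∘ sym ]))
    where
    P∪u? : Decidable (λ x → P x ⊎ x ≡ u)
    P∪u? x = P? x ⊎-dec (x ≟ₐ u)

module _ {P : Pred ℕ 0ℓ} (P? : Decidable P) where

  rise : ∀ {a b} → ¬ P a → P b → a ≤ b → ∃[ u ] a ≤ u × u < b × ¬ P u × P (suc u)
  rise {a} {zero} ¬Pa Pb a≤0 with refl ← n≤0⇒n≡0 a≤0 = contradiction Pb ¬Pa
  rise {a} {suc b} ¬Pa Pb a≤1+b with a≤b ← ≤-pred (≤∧≢⇒< a≤1+b (λ { refl → ¬Pa Pb })) | P? b
  ... | no ¬Pb  = b , a≤b , ≤-refl , ¬Pb , Pb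
  ... | yes Pb′ with u , a≤u , u<b , ¬Pu , P1+u ← rise ¬Pa Pb′ a≤b =
    u , a≤u , m<n⇒m<1+n u<b , ¬Pu , P1+u

module _ {P : Pred ℕ 0ℓ} (P? : Decidable P) where

  fall : ∀ {a b} → P a → ¬ P b → a ≤ b → ∃[ w ] a ≤ w × w < b × P w × ¬ P (suc w)
  fall Pa ¬Pb a≤b with w , a≤w , w<b , ¬¬Pw , ¬P1+w ← rise (¬? ∘ P?) (λ ¬Pa → ¬Pa Pa) ¬Pb a≤b =
    w , a≤w , w<b , decidable-stable (P? w) ¬¬Pw , ¬P1+w

-- occupied X ((i − 1) s) s is Oᵢ, the list of residues of 𝓑ᵢ.
occupied : List ℕ → ℕ → ℕ → List ℕ
occupied X b n = filter (λ r → b + r ∈? X) (upTo n)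

occupied-⊆ : ∀ {q X} b n → Closed q X → occupied X (q + b) n ⊆ occupied X b n
occupied-⊆ {q} {X} b n closed =
  filter⁺ (λ r → q + b + r ∈? X) (λ r → b + r ∈? X) (λ { refl → closed-shift closed b _ })
          (⊆-refl {x = upTo n})

module _ (s : ℕ) .{{_ : NonZero s}} (X : List ℕ) (i : ℕ) where

  private
    b : ℕ
    b = (i ∸ 1) * s

  block-occupied : block s X i ≡ map (b +_) (occupied X b s)
  block-occupied = filter-map (_∈? X) (b +_) (upTo s)

  acount-occupied : acount s X i ≡ length (occupied X b s)
  acount-occupied = trans (cong length block-occupied) (length-map (b +_) (occupied X b s))

  nmax-occupied : nmax s X i ≡ max (map (_% s) (occupied X b s))
  nmax-occupied = cong max (begin
    map (_% s) (block s X i)                    ≡⟨ cong (map (_% s)) block-occupied ⟩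
    map (_% s) (map (b +_) (occupied X b s))    ≡⟨ map-∘ (occupied X b s) ⟨
    map ((_% s) ∘ (b +_)) (occupied X b s)      ≡⟨ map-cong offset-residue (occupied X b s) ⟩
    map (_% s) (occupied X b s)                 ∎)
    where
    open ≡-Reasoning
    offset-residue : ∀ r → (b + r) % s ≡ r % s
    offset-residue r = trans (cong (_% s) (+-comm b r)) ([m+kn]%n≡m%n r (i ∸ 1) s)

module _ {s} .{{_ : NonZero s}} {X} (closed : Closed s X) where

  private
    next⊆ : ∀ j → occupied X (s + j * s) s ⊆ occupied X (j * s) s
    next⊆ j = occupied-⊆ (j * s) s closed

  acount-antitone : ∀ i → acount s X (suc i) ≤ acount s X i
  acount-antitone zero    = ≤-refl
  acount-antitone (suc j) =
    subst₂ _≤_ (sym (acount-occupied s X (2 + j))) (sym (acount-occupied s X (suc j)))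
      (length-mono-≤ (next⊆ j))

  nmax-antitone : ∀ i → nmax s X (suc i) ≤ nmax s X i
  nmax-antitone zero    = ≤-refl
  nmax-antitone (suc j) =
    subst₂ _≤_ (sym (nmax-occupied s X (2 + j))) (sym (nmax-occupied s X (suc j)))
      (max-mono (map⁺ (_% s) (next⊆ j)))

  nmax-≡ : ∀ i → acount s X i ≡ acount s X (suc i) → nmax s X i ≡ nmax s X (suc i)
  nmax-≡ zero    _ = refl
  nmax-≡ (suc j) a≡ = begin
    nmax s X (suc j)                             ≡⟨ nmax-occupied s X (suc j) ⟩
    max (map (_% s) (occupied X (j * s) s))      ≡⟨ cong (max ∘ map (_% s)) occupied≡ ⟨
    max (map (_% s) (occupied X (s + j * s) s))  ≡⟨ nmax-occupied s X (2 + j) ⟨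
    nmax s X (2 + j)                             ∎
    where
    open ≡-Reasoning
    occupied≡ : occupied X (s + j * s) s ≡ occupied X (j * s) s
    occupied≡ = ⊆-length-≡ (sym (trans (sym (acount-occupied s X (suc j)))
                  (trans a≡ (acount-occupied s X (2 + j))))) (next⊆ j)

InP-intro : ∀ m s i k r {x} → x ≡ i * (m * s) + (r + k * s) →
            i < r → r + i < s → (suc k ≡ m → suc (r + i) < s) → InP m s (suc k) x
InP-intro m s i k r x≡ i<r r+i<s last =
  i , r + k * s , trans x≡ (cong (_+ (r + k * s)) (sym (*-assoc i m s))) ,
  subst (_≤ r + k * s) (arith₁ i (k * s)) (+-monoˡ-≤ (k * s) i<r) ,
  subst (_≤ s + k * s) (arith₂ 1 r i (k * s)) (+-monoˡ-≤ (k * s) r+i<s) ,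
  λ { refl → subst (_≤ s + k * s) (arith₂ 2 r i (k * s)) (+-monoˡ-≤ (k * s) (last refl)) }
  where
  arith₁ : ∀ i t → suc i + t ≡ t + 1 + i
  arith₁ = solve-∀
  arith₂ : ∀ c r i t → c + (r + i) + t ≡ r + t + i + c
  arith₂ = solve-∀

module Avoiding (s′ m′ : ℕ) (X : List ℕ) (0∉X : 0 ∉ X)
  (closedₛ : Closed (suc s′) X)
  (closed₋ : Closed (suc m′ * suc s′ ∸ 1) X)
  (closed₊ : Closed (suc m′ * suc s′ + 1) X) where

  s m M p : ℕ
  s = suc s′
  m = suc m′
  M = m * s
  p = M ∸ 1

  closedₘ : Closed M X
  closedₘ = closed-multiple closedₛ m

  closed₊′ : Closed (suc M) X
  closed₊′ = subst (λ q → Closed q X) (+-comm M 1) closed₊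

  semigroup-∉ : ∀ a b c e → a * s + b * M + c * p + e * suc M ∉ X
  semigroup-∉ a b c e =
    0∉X ∘ closed-multiple closedₛ a 0 ∘ closed-multiple closedₘ b _
        ∘ closed-multiple closed₋ c _ ∘ closed-multiple closed₊′ e _

  small-offset-∉ : ∀ i k r → r ≤ i → i * M + (r + k * s) ∉ X
  small-offset-∉ i k r r≤i with d , refl ← m≤n⇒∃[o]m+o≡n r≤i =
    semigroup-∉ k d 0 r ∘ subst (_∈ X) (arith r d k s M p)
    where
    arith : ∀ r d k s M p → (r + d) * M + (r + k * s) ≡ k * s + d * M + 0 * p + r * suc M
    arith = solve-∀

  large-offset-∉ : ∀ i k r → r < s → s ≤ r + i → i * M + (r + k * s) ∉ X
  large-offset-∉ i k r r<s s≤r+i with e , refl ← m≤n⇒∃[o]m+o≡n (≤-pred r<s)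
    with d , refl ← m≤n⇒∃[o]m+o≡n (+-cancelˡ-≤ r (suc e) i (subst (_≤ r + i) (sym (+-suc r e)) s≤r+i))
    =
    semigroup-∉ (suc k) d (suc e) 0 ∘ subst (_∈ X) (arith r e k d p)
    where
    arith : ∀ r e k d p → (suc e + d) * suc p + (r + k * suc (r + e))
                          ≡ suc k * suc (r + e) + d * suc p + suc e * p + 0 * suc (suc p)
    arith = solve-∀

  top-offset-∉ : ∀ i r → suc (r + i) ≡ s → i * M + (r + m′ * s) ∉ X
  top-offset-∉ i r refl = semigroup-∉ 0 0 (suc i) 0 ∘ subst (_∈ X) (arith i r (m′ * s))
    where
    arith : ∀ i r t → i * suc (r + i + t) + (r + t)
                      ≡ 0 * suc (r + i) + 0 * suc (r + i + t) + suc i * (r + i + t)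
                        + 0 * suc (suc (r + i + t))
    arith = solve-∀

  ∈⇒InL : ∀ {x} → x ∈ X → InL m s x
  ∈⇒InL {x} x∈X = suc k , s≤s z≤n , k<m , InP-intro m s i k r x≡ i<r r+i<s last
    where
    i j k r : ℕ
    i = x / M
    j = x % M
    k = j / s
    r = j % s
    x≡ : x ≡ i * M + (r + k * s)
    x≡ = begin
      x                  ≡⟨ m≡m%n+[m/n]*n x M ⟩
      j + i * M          ≡⟨ +-comm j (i * M) ⟩
      i * M + j          ≡⟨ cong (i * M +_) (m≡m%n+[m/n]*n j s) ⟩
      i * M + (r + k * s) ∎
      where open ≡-Reasoning
    x∈ : i * M + (r + k * s) ∈ X
    x∈ = subst (_∈ X) x≡ x∈X
    k<m : suc k ≤ m
    k<m = m<n*o⇒m/o<n (m%n<n x M)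
    i<r : i < r
    i<r with i <? r
    ... | yes i<r = i<r
    ... | no  i≮r = contradiction x∈ (small-offset-∉ i k r (≮⇒≥ i≮r))
    r+i<s : r + i < s
    r+i<s with r + i <? s
    ... | yes r+i<s = r+i<s
    ... | no  r+i≮s = contradiction x∈ (large-offset-∉ i k r (m%n<n j s) (≮⇒≥ r+i≮s))
    last : suc k ≡ m → suc (r + i) < s
    last 1+k≡m with suc (r + i) <? s
    ... | yes 1+r+i<s = 1+r+i<s
    ... | no  1+r+i≮s =
      contradiction (subst (λ k → i * M + (r + k * s) ∈ X) (suc-injective 1+k≡m) x∈)
                    (top-offset-∉ i r (≤-antisym r+i<s (≮⇒≥ 1+r+i≮s)))

  first-offset-free : ∀ j → M + j * s + 0 ∉ X
  first-offset-free j = semigroup-∉ j 1 0 0 ∘ subst (_∈ X) (arith M (j * s) p)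
    where
    arith : ∀ M t p → M + t + 0 ≡ t + 1 * M + 0 * p + 0 * suc M
    arith = solve-∀

  last-offset-free : ∀ j → M + j * s + s′ ∉ X
  last-offset-free j = semigroup-∉ (suc j) 0 1 0 ∘ subst (_∈ X) (arith s′ (m′ * s) j)
    where
    arith : ∀ s′ q j → suc (s′ + q) + j * suc s′ + s′
                       ≡ suc j * suc s′ + 0 * suc (s′ + q) + 1 * (s′ + q) + 0 * suc (suc (s′ + q))
    arith = solve-∀

  Fresh : ℕ → ℕ → Set
  Fresh j r = j * s + r ∈ X × M + j * s + r ∉ X

  two-fresh-offsets : ∀ j {r₀} → r₀ < s → M + j * s + r₀ ∈ X →
                      ∃[ u ] ∃[ v ] u < v × v < s × Fresh j u × Fresh j v
  two-fresh-offsets j {r₀} r₀<s Fr₀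
    with u , _ , u<r₀ , ¬Fu , F[1+u] ←
           rise (λ r → M + j * s + r ∈? X) (first-offset-free j) Fr₀ z≤n
       | w , r₀≤w , w<s′ , Fw , ¬F[1+w] ←
           fall (λ r → M + j * s + r ∈? X) Fr₀ (last-offset-free j) (≤-pred r₀<s) =
    u , suc w , ≤-trans u<r₀ (m≤n⇒m≤1+n r₀≤w) , s≤s w<s′ ,
    (closed₊′ (j * s + u) (subst (_∈ X) (arith₊ M (j * s) u) F[1+u]) , ¬Fu) ,
    (closed₋ (j * s + suc w) (subst (_∈ X) (arith₋ p (j * s) w) Fw) , ¬F[1+w])
    where
    arith₊ : ∀ M t u → M + t + suc u ≡ t + u + suc M
    arith₊ = solve-∀
    arith₋ : ∀ p t w → suc p + t + w ≡ t + suc w + p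
    arith₋ = solve-∀

  occupied-drop : ∀ j → 0 < length (occupied X (M + j * s) s) →
                  length (occupied X (M + j * s) s) + 2 ≤ length (occupied X (j * s) s)
  occupied-drop j 0<ℓ = from-member (proj₂ (0<length⇒∃∈ 0<ℓ))
    where
    F? : Decidable (λ r → M + j * s + r ∈ X)
    F? r = M + j * s + r ∈? X
    G? : Decidable (λ r → j * s + r ∈ X)
    G? r = j * s + r ∈? X
    count : ∃[ u ] ∃[ v ] u < v × v < s × Fresh j u × Fresh j v →
            length (filter F? (upTo s)) + 2 ≤ length (filter G? (upTo s))
    count (u , v , u<v , v<s , (Gu , ¬Fu) , (Gv , ¬Fv)) =
      filter-length-+2 _≟_ F? G? (closed-shift closedₘ (j * s) _) (upTo s)
        (∈-upTo⁺ (<-trans u<v v<s)) (∈-upTo⁺ v<s) (<⇒≢ u<v) Gu ¬Fu Gv ¬Fv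
    from-member : ∀ {r₀} → r₀ ∈ filter F? (upTo s) →
                  length (filter F? (upTo s)) + 2 ≤ length (filter G? (upTo s))
    from-member r₀∈ with r₀∈upTo , Fr₀ ← ∈-filter⁻ F? {xs = upTo s} r₀∈ =
      count (two-fresh-offsets j (∈-upTo⁻ r₀∈upTo) Fr₀)

  acount-occupied-+m : ∀ j → acount s X (suc j + m) ≡ length (occupied X (M + j * s) s)
  acount-occupied-+m j = trans (acount-occupied s X (suc j + m))
    (cong (λ b → length (occupied X b s)) (trans (*-distribʳ-+ s j m) (+-comm (j * s) M)))

  acount-drop : ∀ i → 1 ≤ i → 0 < acount s X (i + m) → acount s X (i + m) + 2 ≤ acount s X i
  acount-drop (suc j) _ 0<a =
    subst₂ (λ a b → a + 2 ≤ b) (sym (acount-occupied-+m j)) (sym (acount-occupied s X (suc j)))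
      (occupied-drop j (subst (0 <_) (acount-occupied-+m j) 0<a))

  t : ℕ
  t = suc (max X / M)

  t-is-T : X ≢ [] → IsT m s X t
  t-is-T X≢[] = s≤s z≤n , below-t , t-least
    where
    below-t : ∀ x → x ∈ X → x < t * m * s
    below-t x x∈X = subst (x <_) (sym (*-assoc t m s)) (begin-strict
      x                              ≤⟨ ∈⇒≤max x∈X ⟩
      max X                          ≡⟨ m≡m%n+[m/n]*n (max X) M ⟩
      max X % M + max X / M * M      <⟨ +-monoˡ-< (max X / M * M) (m%n<n (max X) M) ⟩
      t * M                          ∎)
      where open ≤-Reasoning
    t-least : ∀ i → 1 ≤ i → (∀ x → x ∈ X → x < i * m * s) → t ≤ i
    t-least i _ X<ims =
      m<n*o⇒m/o<n (max< X≢[] (λ {x} x∈X → subst (x <_) (*-assoc i m s) (X<ims x x∈X)))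

  genBeta : X ≢ [] → GenBeta m s X
  genBeta X≢[] =
    X≢[] , All.tabulate ∈⇒InL , t , t-is-T X≢[] ,
    (λ i _ _ aᵢ≡0 → n≤0⇒n≡0 (subst (acount s X (suc i) ≤_) aᵢ≡0 (acount-antitone closedₛ i))) ,
    (λ i _ _ _ → acount-antitone closedₛ i) ,
    (λ i 1≤i _ → acount-drop i 1≤i) ,
    (λ i _ _ _ _ → nmax-antitone closedₛ i) ,
    (λ i _ _ _ aᵢ≡aᵢ₊₁ _ → nmax-≡ closedₛ i aᵢ≡aᵢ₊₁) ,
    (λ _ → subst (λ k → acount s X k ≤ acount s X ((t ∸ 1) * m)) (+-comm 1 ((t ∸ 1) * m))
                 (acount-antitone closedₛ ((t ∸ 1) * m)))

lemma4p4 : (s m : ℕ) .{{_ : NonZero s}} .{{_ : NonZero m}} (la : List ℕ) →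
    IsPartition la → la ≢ [] →
    IsCore s la → IsCore (m * s ∸ 1) la → IsCore (m * s + 1) la →
    GenBeta m s (beta la)
lemma4p4 (suc s′) (suc m′) [] _ la≢[] _ _ _ = contradiction refl la≢[]
lemma4p4 (suc s′) (suc m′) la@(_ ∷ _) partition@(_ , pos) _ coreₛ core₋ core₊ =
  Avoiding.genBeta s′ m′ (beta la) (0∉β pos)
    (core⇒β-closed la partition coreₛ)
    (core⇒β-closed la partition core₋)
    (core⇒β-closed la partition core₊)
    (λ ())
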